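{- Let $\mathfrak S=(S,F,\leq)$ be an $\infty$-effective complete functional WSTS and $s_0\in S$. Consider an execution of the procedure $\mathbf{Clover}_{\mathfrak S}$ on input $s_0$, and let $A_n$ be the value of the set $A$ after $n$ iterations of the while loop. If $\bigcup_n A_n$ is finite, then the procedure terminates on input $s_0$.
   Context: Poset notions: ${\downarrow}$ downward closure, $\mathrm{Max}$ maximal elements, directed sets, dcpo, continuous dcpo, wpo (every infinite sequence has $i<j$ with $x_i\leq x_j$), dcwo = dcpo + wpo; Scott-open sets. A complete WSTS is $(S,F,\leq)$ with $(S,\leq)$ a continuous dcwo and $F$ a finite set of partial continuous maps (Scott-open domain, preserving directed suprema inside the domain). $F^*$: finite compositions of maps of $F$. $Post_{\mathfrak S}(A)=\{f(a)\mid f\in F,a\in A\cap\mathrm{dom}f\}$. $A\leq^\flat B$ iff ${\downarrow}A\subseteq{\downarrow}B$. Lub-acceleration: $g^\infty(x)=\bigvee_ng^n(x)$ if $x<g(x)$, $g^\infty(x)=g(x)$ otherwise ($x\in\mathrm{dom}\,g$). $\infty$-effective: natural-number codes for states, decidable $\leq$, computable maps with decidable domains, computable $g^\infty$ for every $g\in F^*$. Procedure $\mathbf{Clover}_{\mathfrak S}(s_0)$: $A\leftarrow\{s_0\}$; while $Post_{\mathfrak S}(A)\not\leq^\flat A$, choose fairly $(g,a)\in F^*\times A$ with $a\in\mathrm{dom}\,g$, and set $A\leftarrow A\cup\{g^\infty(a)\}$; return $\mathrm{Max}\,A$. Fairness: on every infinite execution, every pair $(g,a)\in F^*\times A_m$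 with $a\in\mathrm{dom}\,g$ is picked at some iteration $n\geq m$. -}

module Defs where

open import Level using (Level; 0ℓ) renaming (suc to lsuc)
open import Data.Nat using (ℕ; zero; suc; _<_; _≥_)
open import Data.Fin using (Fin)
open import Data.List using (List; []; _∷_)
open import Data.List.Membership.Propositional using (_∈_)
open import Data.Maybe using (Maybe; just; nothing; _>>=_)
open import Data.Product using (Σ; ∃; _×_; _,_)
open import Data.Sum using (_⊎_)
open import Relation.Nullary using (¬_)
open import Relation.Unary using (Pred; _⊆_)
open import Relation.Binary using (Rel; IsPartialOrder; Decidable)
open import Relation.Binary.PropositionalEquality using (_≡_; _≢_)
open import Function using (Injective)

module Order {S : Set} (_≤_ : Rel S 0ℓ) where

  _<ₛ_ : Rel S 0ℓ
  x <ₛ y = x ≤ y × x ≢ y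

  ↓ : Pred S 0ℓ → Pred S 0ℓ
  ↓ A x = ∃ λ a → A a × x ≤ a

  _≤♭_ : Pred S 0ℓ → Pred S 0ℓ → Set
  A ≤♭ B = ↓ A ⊆ ↓ B

  Directed : ∀ {ℓ} → Pred S ℓ → Set ℓ
  Directed D = (∃ λ x → D x)
             × (∀ {x y} → D x → D y → ∃ λ z → D z × x ≤ z × y ≤ z)

  IsLub : ∀ {ℓ} → Pred S ℓ → S → Set ℓ
  IsLub D s = (∀ {x} → D x → x ≤ s)
            × (∀ u → (∀ {x} → D x → x ≤ u) → s ≤ u)

  IsDcpo : Set₁
  IsDcpo = ∀ (D : Pred S 0ℓ) → Directed D → ∃ λ s → IsLub D s

  IsWpo : Set
  IsWpo = ∀ (x : ℕ → S) → ∃ λ i → ∃ λ j → i < j × x i ≤ x j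

  _≪_ : S → S → Set₁
  x ≪ y = ∀ (D : Pred S 0ℓ) → Directed D → ∀ s → IsLub D s → y ≤ s →
          ∃ λ d → D d × x ≤ d

  IsContinuous : Set₁
  IsContinuous = ∀ x → Directed (λ y → y ≪ x) × IsLub (λ y → y ≪ x) x

  IsScottOpen : Pred S 0ℓ → Set₁
  IsScottOpen U = (∀ {x y} → U x → x ≤ y → U y)
                × (∀ (D : Pred S 0ℓ) → Directed D → ∀ s → IsLub D s → U s →
                   ∃ λ d → D d × U d)

  -- Partial maps are represented as S → Maybe S (domain = where 'just').
  dom : (S → Maybe S) → Pred S 0ℓ
  dom f x = ∃ λ y → f x ≡ just y

  IsPartialContinuous : (S → Maybe S) → Set₁
  IsPartialContinuous f =
    IsScottOpen (dom f)
    × (∀ (D : Pred S 0ℓ) → Directed D → D ⊆ dom f →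
         ∀ s → IsLub D s → ∀ b → f s ≡ just b →
         IsLub (λ y → ∃ λ x → D x × f x ≡ just y) b)

record CompleteWSTS : Set₁ where
  field
    S      : Set
    _≤_    : Rel S 0ℓ
    isPartialOrder : IsPartialOrder _≡_ _≤_
    k      : ℕ
    F      : Fin k → S → Maybe S
  open Order _≤_ public
  field
    dcpo       : IsDcpo
    wpo        : IsWpo
    continuous : IsContinuous
    F-cont     : ∀ i → IsPartialContinuous (F i)

  -- F* : finite compositions of maps of F, given by words over Fin k
  -- (the empty word is the identity). Word [i₁,…,iₙ] denotes
  -- F iₙ ∘ … ∘ F i₁ (as partial maps).
  run : List (Fin k) → S → Maybe S
  run []       x = just x
  run (i ∷ w)  x = F i x >>= run w

  iter : (S → Maybe S) → ℕ → S → Maybe S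
  iter g zero    x = just x
  iter g (suc n) x = iter g n x >>= g

  IsAccel : List (Fin k) → S → S → S → Set
  IsAccel g a b y =
      (a <ₛ b → IsLub (λ z → ∃ λ n → iter (run g) n a ≡ just z) y)
    × (¬ (a <ₛ b) → y ≡ b)

  Post : List S → Pred S 0ℓ
  Post A y = ∃ λ i → ∃ λ a → a ∈ A × F i a ≡ just y

  ⟦_⟧ : List S → Pred S 0ℓ
  ⟦ A ⟧ x = x ∈ A

  -- loop guard negated: the while loop exits at A
  Exit : List S → Set
  Exit A = Post A ≤♭ ⟦ A ⟧

-- ∞-effectiveness: codes, decidable order, computable maps with
-- decidable domains (automatic for S → Maybe S), computable g^∞.
record InfEffective (𝔖 : CompleteWSTS) : Set where
  open CompleteWSTS 𝔖
  field
    code       : S → ℕ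
    code-inj   : Injective _≡_ _≡_ code
    _≤?_       : Decidable _≤_
    accel      : ∀ g a b → run g a ≡ just b → ∃ λ y → IsAccel g a b y

-- A n : value of A after n iterations (a finite set as a list);
-- pick n : the pair (g , a) chosen at iteration n.
-- After the loop has exited, A stays constant.

record Execution (𝔖 : CompleteWSTS) (s₀ : CompleteWSTS.S 𝔖) : Set where
  open CompleteWSTS 𝔖
  field
    A     : ℕ → List S
    pick  : ℕ → List (Fin k) × S
    init  : A 0 ≡ s₀ ∷ []
    step  : ∀ n →
              (Exit (A n) × A (suc n) ≡ A n)
            ⊎ (¬ Exit (A n) ×
               ∃ λ g → ∃ λ a → ∃ λ b → ∃ λ y →
                 pick n ≡ (g , a) × a ∈ A n × run g a ≡ just b ×
                 IsAccel g a b y × A (suc n) ≡ y ∷ A n)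
    fair  : ∀ m g a → a ∈ A m → dom (run g) a →
              ∃ λ n → n ≥ m × (Exit (A n) ⊎ pick n ≡ (g , a))

UnionFinite : ∀ {𝔖 s₀} → Execution 𝔖 s₀ → Set
UnionFinite {𝔖} E = ∃ λ (L : List S) → ∀ n x → x ∈ A n → x ∈ L
  where open CompleteWSTS 𝔖
        open Execution E

Terminates : ∀ {𝔖 s₀} → Execution 𝔖 s₀ → Set
Terminates {𝔖} E = ∃ λ n → Exit (A n)
  where open CompleteWSTS 𝔖
        open Execution E

module Submission where

-- The measure is the number of entries of L still missing from Aₘ.  If the
-- loop has not exited at Aₘ, some successor y = F i a (a ∈ Aₘ) lies outside
-- ↓Aₘ; this is decidable because ≤ is decidable, F is finite and Aₘ is a
-- finite list.  By fairness the pair (i , a) is picked at some step n ≥ m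
-- (unless the loop has exited by then), and the value added there is the
-- lub-acceleration of a along F i, which lies above y and is therefore not
-- in Aₘ.  Since the Aₙ grow monotonically, the measure strictly decreases
-- from Aₘ to Aₙ₊₁, and well-founded induction on ℕ yields termination.

open import Defs
open import Data.Nat using (ℕ; suc; _+_; _<_; _≤′_; ≤′-refl; ≤′-step; z≤n; s≤s) renaming (_≤_ to _≤ℕ_)
open import Data.Nat.Properties
  using (≤⇒≤′; m≤n⇒m≤1+n; +-mono-≤; +-mono-<-≤; +-mono-≤-<)
open import Data.Nat.Induction using (<-wellFounded)
open import Data.Fin using (Fin)
import Data.Fin.Properties as Fin
open import Data.List using (List; []; _∷_)
open import Data.List.Membership.Propositional using (_∈_; _∉_; find; lose)
open import Data.List.Relation.Binary.Subset.Propositional using (_⊆_)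
open import Data.List.Relation.Unary.Any using (here; there; any?)
open import Data.List.Relation.Unary.All using (All; all?; lookup)
open import Data.List.Relation.Unary.All.Properties using (¬All⇒Any¬)
import Data.List.Membership.DecPropositional as DecMembership
open import Data.Maybe using (just; nothing; _>>=_)
open import Data.Maybe.Properties using (just-injective)
open import Data.Product using (∃; _×_; _,_; proj₁)
open import Data.Sum using (_⊎_; inj₁; inj₂)
open import Induction.WellFounded using (Acc; acc)
open import Relation.Nullary using (¬_; Dec; yes; no; ¬?; contradiction)
open import Relation.Nullary.Decidable using (_×-dec_)
import Relation.Nullary.Decidable as Dec
open import Relation.Binary using (Decidable; DecidableEquality; IsPartialOrder)
open import Relation.Binary.PropositionalEquality using (_≡_; refl; sym; trans; cong; subst)
import Relation.Binary.Properties.Poset as PosetProperties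

module Missing {a} {X : Set a} (_≟_ : DecidableEquality X) where
  open DecMembership _≟_ using (_∈?_)

  absent : X → List X → ℕ
  absent z B with z ∈? B
  ... | yes _ = 0
  ... | no  _ = 1

  missing : List X → List X → ℕ
  missing []      B = 0
  missing (z ∷ L) B = absent z B + missing L B

  absent-mono : ∀ {B C} z → B ⊆ C → absent z C ≤ℕ absent z B
  absent-mono {B} {C} z B⊆C with z ∈? C | z ∈? B
  ... | yes _ | _     = z≤n
  ... | no  _ | no  _ = s≤s z≤n
  ... | no z∉C | yes z∈B = contradiction (B⊆C z∈B) z∉C

  absent-new : ∀ {B C z} → z ∈ C → z ∉ B → absent z C < absent z B
  absent-new {B} {C} {z} z∈C z∉B with z ∈? C | z ∈? B
  ... | yes _ | no  _   = s≤s z≤n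
  ... | yes _ | yes z∈B = contradiction z∈B z∉B
  ... | no z∉C | _      = contradiction z∈C z∉C

  missing-mono : ∀ {B C} L → B ⊆ C → missing L C ≤ℕ missing L B
  missing-mono []      B⊆C = z≤n
  missing-mono (z ∷ L) B⊆C = +-mono-≤ (absent-mono z B⊆C) (missing-mono L B⊆C)

  missing-strict : ∀ {B C z} L → B ⊆ C → z ∈ L → z ∈ C → z ∉ B →
                   missing L C < missing L B
  missing-strict (_ ∷ L) B⊆C (here refl) z∈C z∉B =
    +-mono-<-≤ (absent-new z∈C z∉B) (missing-mono L B⊆C)
  missing-strict (y ∷ L) B⊆C (there z∈L) z∈C z∉B =
    +-mono-≤-< (absent-mono y B⊆C) (missing-strict L B⊆C z∈L z∈C z∉B)

module _ (𝔖 : CompleteWSTS) where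
  open CompleteWSTS 𝔖
  open IsPartialOrder isPartialOrder using (reflexive) renaming (trans to ≤-trans)

  Violation : List S → Set
  Violation A = ∃ λ i → ∃ λ a → ∃ λ y → a ∈ A × F i a ≡ just y × ¬ ↓ ⟦ A ⟧ y

  Closed : List S → S → Fin k → Set
  Closed A a i = ∀ {y} → F i a ≡ just y → ↓ ⟦ A ⟧ y

  closed⇒exit : ∀ {A} → All (λ a → ∀ i → Closed A a i) A → Exit A
  closed⇒exit closed (p , (i , a , a∈A , Fia≡p) , x≤p) with lookup closed a∈A i Fia≡p
  ... | b , b∈A , p≤b = b , b∈A , ≤-trans x≤p p≤b

  unclosed⇒successor : ∀ {A a i} → ¬ Closed A a i →
                       ∃ λ y → F i a ≡ just y × ¬ ↓ ⟦ A ⟧ y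
  unclosed⇒successor {A} {a} {i} ¬closed with F i a
  ... | just y  = y , refl , λ y∈↓A → ¬closed λ { refl → y∈↓A }
  ... | nothing = contradiction (λ ()) ¬closed

  run-single : ∀ {i a y} → F i a ≡ just y → run (i ∷ []) a ≡ just y
  run-single Fia≡y = cong (_>>= run []) Fia≡y

  module Decisions (_≤?_ : Decidable _≤_) where
    _≟_ : DecidableEquality S
    _≟_ = PosetProperties.≤-dec⇒≈-dec
            (record { Carrier = S ; _≈_ = _≡_ ; _≤_ = _≤_ ; isPartialOrder = isPartialOrder })
            _≤?_

    ↓? : ∀ A y → Dec (↓ ⟦ A ⟧ y)
    ↓? A y = Dec.map′ find (λ (_ , a∈A , y≤a) → lose a∈A y≤a) (any? (y ≤?_) A)

    closed? : ∀ A a i → Dec (Closed A a i)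
    closed? A a i with F i a
    ... | just y  = Dec.map′ (λ y∈↓A → λ { refl → y∈↓A }) (λ closed → closed refl) (↓? A y)
    ... | nothing = yes λ ()

    exit-or-violation : ∀ A → Exit A ⊎ Violation A
    exit-or-violation A with all? (λ a → Fin.all? (closed? A a)) A
    ... | yes closed = inj₁ (closed⇒exit closed)
    ... | no ¬closed with find (¬All⇒Any¬ (λ a → Fin.all? (closed? A a)) A ¬closed)
    ...   | a , a∈A , ¬∀closed with Fin.¬∀⟶∃¬ k _ (closed? A a) ¬∀closed
    ...     | i , ¬closed-i with unclosed⇒successor ¬closed-i
    ...       | y , Fia≡y , y∉↓A = inj₂ (i , a , y , a∈A , Fia≡y , y∉↓A)

    accel-≥ : ∀ {g a b y} → IsAccel g a b y → run g a ≡ just b → b ≤ y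
    accel-≥ {a = a} {b} (lub , stays) gab with a ≤? b ×-dec ¬? (a ≟ b)
    ... | yes a<b = proj₁ (lub a<b) (1 , gab)
    ... | no  a≮b = reflexive (sym (stays a≮b))

    module Run {s₀} (E : Execution 𝔖 s₀) where
      open Execution E

      A-step : ∀ n → A n ⊆ A (suc n)
      A-step n x∈An with step n
      ... | inj₁ (_ , A≡) = subst (_ ∈_) (sym A≡) x∈An
      ... | inj₂ (_ , _ , _ , _ , _ , _ , _ , _ , _ , A≡) = subst (_ ∈_) (sym A≡) (there x∈An)

      A-mono : ∀ {m n} → m ≤ℕ n → A m ⊆ A n
      A-mono m≤n = along (≤⇒≤′ m≤n)
        where
        along : ∀ {m n} → m ≤′ n → A m ⊆ A n
        along ≤′-refl        x∈ = x∈
        along (≤′-step m≤′n) x∈ = A-step _ (along m≤′n x∈)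

      Fresh : ℕ → ℕ → Set
      Fresh m n = ∃ λ z → z ∈ A n × z ∉ A m

      picked-successor : ∀ {g a′ b i a y} → (g , a′) ≡ (i ∷ [] , a) →
                         run g a′ ≡ just b → F i a ≡ just y → b ≡ y
      picked-successor refl gab Fia≡y = just-injective (trans (sym gab) (run-single Fia≡y))

      -- fairness resolves a violation at Aₘ: either the loop exits, or some
      -- later step adds an element above the violating successor, new for Aₘ
      resolve : ∀ m → Violation (A m) →
                Terminates E ⊎ ∃ λ n → m ≤ℕ n × Fresh m (suc n)
      resolve m (i , a , y , a∈Am , Fia≡y , y∉↓Am)
        with fair m (i ∷ []) a a∈Am (y , run-single Fia≡y)
      ... | n , _ , inj₁ exit = inj₁ (n , exit)
      ... | n , m≤n , inj₂ picked with step n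
      ...   | inj₁ (exit , _) = inj₁ (n , exit)
      ...   | inj₂ (_ , g , _ , _ , z , picked′ , _ , gab , accel , A≡) =
                inj₂ (n , m≤n , z , z∈ , z∉)
        where
        y≤z : y ≤ z
        y≤z = subst (_≤ z) (picked-successor (trans (sym picked′) picked) gab Fia≡y)
                    (accel-≥ {g} accel gab)
        z∈ : z ∈ A (suc n)
        z∈ = subst (z ∈_) (sym A≡) (here refl)
        z∉ : z ∉ A m
        z∉ z∈Am = y∉↓Am (z , z∈Am , y≤z)

      terminates-from : (L : List S) → (∀ n x → x ∈ A n → x ∈ L) →
                        ∀ m → Acc _<_ (Missing.missing _≟_ L (A m)) → Terminates E
      terminates-from L U m (acc smaller) with exit-or-violation (A m)
      ... | inj₁ exit = m , exit
      ... | inj₂ violation with resolve m violation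
      ...   | inj₁ done = done
      ...   | inj₂ (n , m≤n , z , z∈ , z∉) =
                terminates-from L U (suc n) (smaller
                  (Missing.missing-strict _≟_ L (A-mono (m≤n⇒m≤1+n m≤n)) (U _ z z∈) z∈ z∉))

proposition5p4 : (𝔖 : CompleteWSTS) → InfEffective 𝔖 →
    (s₀ : CompleteWSTS.S 𝔖) → (E : Execution 𝔖 s₀) →
    UnionFinite E → Terminates E
proposition5p4 𝔖 eff s₀ E (L , U) = terminates-from L U 0 (<-wellFounded _)
  where
  open InfEffective eff using (_≤?_)
  open Decisions 𝔖 _≤?_
  open Run E
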